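{- For each integer $n\geq 5$, there are infinitely many CS $n$-sets whose elements are pairwise distinct.
   Context: A CS-set is a finite multiset $\langle a_1,\dots,a_n\rangle$ of integers (repeated elements allowed, order irrelevant) such that $a_1^3+a_2^3+\cdots+a_n^3=(a_1+a_2+\cdots+a_n)^2$, where it is required that no $a_i$ equals $0$ and that the multiset does not contain both $k$ and $-k$ for any integer $k$. A CS $n$-set is a CS-set with exactly $n$ elements (counted with multiplicity); entries may be negative. -}

module Defs where

open import Data.Integer using (ℤ; +_; _+_; _*_; -_)
open import Data.List using (List; []; _∷_; map; length)
open import Data.List.Membership.Propositional using (_∈_; _∉_)
open import Data.List.Relation.Unary.Unique.Propositional using (Unique)
open import Data.List.Relation.Binary.Permutation.Propositional using (_↭_)
open import Data.List.Relation.Unary.All using (All)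
open import Data.Product using (_×_)
open import Data.Nat using (ℕ)
open import Relation.Nullary using (¬_)
open import Relation.Binary.PropositionalEquality using (_≡_; _≢_)

-- A multiset of integers is represented by a list, considered up to
-- permutation (_↭_).

sumℤ : List ℤ → ℤ
sumℤ [] = + 0
sumℤ (x ∷ xs) = x + sumℤ xs

cube : ℤ → ℤ
cube x = x * x * x

IsCS : List ℤ → Set
IsCS as =
  (sumℤ (map cube as) ≡ sumℤ as * sumℤ as)
  × All (λ a → a ≢ + 0) as
  × All (λ a → (- a) ∉ as) as

IsCSn : ℕ → List ℤ → Set
IsCSn n as = IsCS as × length as ≡ n

IsDistinctCSn : ℕ → List ℤ → Set
IsDistinctCSn n as = IsCSn n as × Unique as

-- Multisets are equal iff the lists are permutations of each other.
-- "Infinitely many" P-multisets: every finite family of multisets misses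
-- some multiset satisfying P.
InfinitelyManyMultisets : (List ℤ → Set) → Set
InfinitelyManyMultisets P =
  (F : List (List ℤ)) → Data.Product.∃ λ as → P as × All (λ bs → ¬ (as ↭ bs)) F

{-# OPTIONS --safe #-}
module Submission where

-- The five integers -9, 8, 7, -5, -1 have vanishing sum and vanishing sum
-- of cubes, and both properties survive scaling by any t.  Appending such a
-- block to a set whose sum of cubes is the square of its sum preserves that
-- identity, and {1, …, m} is such a set by Nicomachus' theorem.  For t > m
-- the magnitudes 9t, 8t, 7t, 5t, t, m, …, 1 are pairwise distinct, so
-- {-9t, 8t, 7t, -5t, -t, 1, …, m} is a CS (m+5)-set with distinct elements;
-- letting t grow, its largest magnitude 9t leaves every finite family behind.

open import Defs
open import Data.Nat as ℕ using (ℕ; zero; suc; _≥_; _≤_; _<_; _⊔_; z≤n; s≤s)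
import Data.Nat.Properties as ℕ
open import Data.Integer using (ℤ; +_; -[1+_]; _+_; _*_; -_; ∣_∣; 0ℤ; 1ℤ)
import Data.Integer.Properties as ℤ
open import Data.Integer.Tactic.RingSolver using (solve; solve-∀)
open import Data.List using (List; []; _∷_; map; length; _++_; concat; applyDownFrom)
open import Data.List.Properties using (map-++; length-applyDownFrom)
open import Data.List.Membership.Propositional using (_∈_; _∉_)
open import Data.List.Relation.Unary.Any using (Any; here; there)
-- All's constructors stay qualified: overloading _∷_ makes the solve calls below very slow.
open import Data.List.Relation.Unary.All as All using (All)
import Data.List.Relation.Unary.All.Properties as All
open import Data.List.Relation.Unary.Unique.Propositional using (Unique)
import Data.List.Relation.Unary.Unique.Propositional.Properties as Unique
import Data.List.Relation.Unary.AllPairs as AllPairs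
open import Data.List.Relation.Binary.Disjoint.Propositional using (Disjoint)
open import Data.List.Relation.Binary.Permutation.Propositional.Properties using (Any-resp-↭)
open import Data.Product using (_×_; _,_; ∃)
open import Data.Empty using (⊥-elim)
open import Function using (_∘_)
open import Relation.Nullary.Decidable using (from-yes)
open import Data.List.Relation.Unary.Unique.DecPropositional ℕ._≟_ using (unique?)
open import Relation.Binary.PropositionalEquality
open ≡-Reasoning

sumℤ-++ : ∀ xs ys → sumℤ (xs ++ ys) ≡ sumℤ xs + sumℤ ys
sumℤ-++ []       ys = sym (ℤ.+-identityˡ (sumℤ ys))
sumℤ-++ (x ∷ xs) ys = trans (cong (_+_ x) (sumℤ-++ xs ys)) (sym (ℤ.+-assoc x (sumℤ xs) (sumℤ ys)))

sumℤ-map-*ˡ : ∀ i xs → sumℤ (map (i *_) xs) ≡ i * sumℤ xs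
sumℤ-map-*ˡ i []       = sym (ℤ.*-zeroʳ i)
sumℤ-map-*ˡ i (x ∷ xs) =
  trans (cong (_+_ (i * x)) (sumℤ-map-*ˡ i xs)) (sym (ℤ.*-distribˡ-+ i x (sumℤ xs)))

cube-* : ∀ i j → cube (i * j) ≡ cube i * cube j
cube-* = expanded
  where
  -- the ring solver does not unfold cube
  expanded : ∀ i j → (i * j) * (i * j) * (i * j) ≡ (i * i * i) * (j * j * j)
  expanded = solve-∀

sumℤ-cubes-map-*ˡ : ∀ i xs → sumℤ (map cube (map (i *_) xs)) ≡ cube i * sumℤ (map cube xs)
sumℤ-cubes-map-*ˡ i []       = sym (ℤ.*-zeroʳ (cube i))
sumℤ-cubes-map-*ˡ i (x ∷ xs) =
  trans (cong₂ _+_ (cube-* i x) (sumℤ-cubes-map-*ˡ i xs))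
        (sym (ℤ.*-distribˡ-+ (cube i) (cube x) (sumℤ (map cube xs))))

SumOfCubes≡SquareOfSum : List ℤ → Set
SumOfCubes≡SquareOfSum xs = sumℤ (map cube xs) ≡ sumℤ xs * sumℤ xs

PowerSumsVanish : List ℤ → Set
PowerSumsVanish zs = sumℤ zs ≡ 0ℤ × sumℤ (map cube zs) ≡ 0ℤ

PowerSumsVanish-map-*ˡ : ∀ i zs → PowerSumsVanish zs → PowerSumsVanish (map (i *_) zs)
PowerSumsVanish-map-*ˡ i zs (Σzs≡0 , Σzs³≡0) =
  trans (sumℤ-map-*ˡ i zs) (trans (cong (i *_) Σzs≡0) (ℤ.*-zeroʳ i)) ,
  trans (sumℤ-cubes-map-*ˡ i zs) (trans (cong (cube i *_) Σzs³≡0) (ℤ.*-zeroʳ (cube i)))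

SumOfCubes≡SquareOfSum-++ : ∀ zs xs → PowerSumsVanish zs →
                            SumOfCubes≡SquareOfSum xs → SumOfCubes≡SquareOfSum (zs ++ xs)
SumOfCubes≡SquareOfSum-++ zs xs (Σzs≡0 , Σzs³≡0) Σxs³≡Σxs² = begin
  sumℤ (map cube (zs ++ xs))                ≡⟨ cong sumℤ (map-++ cube zs xs) ⟩
  sumℤ (map cube zs ++ map cube xs)         ≡⟨ sumℤ-++ (map cube zs) (map cube xs) ⟩
  sumℤ (map cube zs) + sumℤ (map cube xs)   ≡⟨ cong₂ _+_ Σzs³≡0 Σxs³≡Σxs² ⟩
  0ℤ + sumℤ xs * sumℤ xs                    ≡⟨ ℤ.+-identityˡ _ ⟩
  sumℤ xs * sumℤ xs                         ≡⟨ cong (λ s → s * s) Σxs≡Σzsxs ⟩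
  sumℤ (zs ++ xs) * sumℤ (zs ++ xs)         ∎
  where
  Σxs≡Σzsxs : sumℤ xs ≡ sumℤ (zs ++ xs)
  Σxs≡Σzsxs = sym (trans (sumℤ-++ zs xs) (trans (cong (_+ sumℤ xs) Σzs≡0) (ℤ.+-identityˡ _)))

oneTo : ℕ → List ℤ
oneTo = applyDownFrom (λ i → + suc i)

triangular-step : ∀ x s → s + s ≡ x * (1ℤ + x) →
                  (1ℤ + x + s) + (1ℤ + x + s) ≡ (1ℤ + x) * (1ℤ + (1ℤ + x))
triangular-step x s 2s≡x[1+x] = begin
  (1ℤ + x + s) + (1ℤ + x + s)          ≡⟨ solve (x ∷ s ∷ []) ⟩
  (1ℤ + x) + (1ℤ + x) + (s + s)        ≡⟨ cong (λ d → (1ℤ + x) + (1ℤ + x) + d) 2s≡x[1+x] ⟩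
  (1ℤ + x) + (1ℤ + x) + x * (1ℤ + x)   ≡⟨ solve (x ∷ []) ⟩
  (1ℤ + x) * (1ℤ + (1ℤ + x))           ∎

nicomachus-step : ∀ x s c → s + s ≡ x * (1ℤ + x) → c ≡ s * s →
                  cube (1ℤ + x) + c ≡ (1ℤ + x + s) * (1ℤ + x + s)
nicomachus-step x s c 2s≡x[1+x] c≡s² = begin
  cube (1ℤ + x) + c                                         ≡⟨ cong (_+_ (cube (1ℤ + x))) c≡s² ⟩
  (1ℤ + x) * (1ℤ + x) * (1ℤ + x) + s * s                    ≡⟨ solve (x ∷ s ∷ []) ⟩
  (1ℤ + x) * (1ℤ + x) + (1ℤ + x) * (x * (1ℤ + x)) + s * s
    ≡⟨ cong (λ d → (1ℤ + x) * (1ℤ + x) + (1ℤ + x) * d + s * s) (sym 2s≡x[1+x]) ⟩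
  (1ℤ + x) * (1ℤ + x) + (1ℤ + x) * (s + s) + s * s          ≡⟨ solve (x ∷ s ∷ []) ⟩
  (1ℤ + x + s) * (1ℤ + x + s)                               ∎

twice-sumℤ-oneTo : ∀ m → sumℤ (oneTo m) + sumℤ (oneTo m) ≡ + m * (1ℤ + + m)
twice-sumℤ-oneTo zero    = refl
twice-sumℤ-oneTo (suc m) = triangular-step (+ m) (sumℤ (oneTo m)) (twice-sumℤ-oneTo m)

nicomachus : ∀ m → SumOfCubes≡SquareOfSum (oneTo m)
nicomachus zero    = refl
nicomachus (suc m) = nicomachus-step (+ m) (sumℤ (oneTo m)) (sumℤ (map cube (oneTo m)))
                                      (twice-sumℤ-oneTo m) (nicomachus m)

Unique-map⇒injectiveOn : ∀ {A B : Set} {f : A → B} {xs x y} →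
                         Unique (map f xs) → x ∈ xs → y ∈ xs → f x ≡ f y → x ≡ y
Unique-map⇒injectiveOn _ (here refl) (here refl) _ = refl
Unique-map⇒injectiveOn (fx∉fxs AllPairs.∷ _) (here refl) (there y∈) fx≡fy =
  ⊥-elim (All.lookup (All.map⁻ fx∉fxs) y∈ fx≡fy)
Unique-map⇒injectiveOn (fy∉fxs AllPairs.∷ _) (there x∈) (here refl) fx≡fy =
  ⊥-elim (All.lookup (All.map⁻ fy∉fxs) x∈ (sym fx≡fy))
Unique-map⇒injectiveOn (_ AllPairs.∷ fxs-unique) (there x∈) (there y∈) fx≡fy =
  Unique-map⇒injectiveOn fxs-unique x∈ y∈ fx≡fy

positive-magnitude⇒≢0 : ∀ {a} → 0 < ∣ a ∣ → a ≢ 0ℤ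
positive-magnitude⇒≢0 0<0 refl = ℕ.<-irrefl refl 0<0

self-opposite⇒≡0 : ∀ a → - a ≡ a → a ≡ 0ℤ
self-opposite⇒≡0 (+ zero)  _ = refl
self-opposite⇒≡0 (+ suc _) ()
self-opposite⇒≡0 -[1+ _ ] ()

distinct-magnitudes⇒no-opposites : ∀ {xs} → Unique (map ∣_∣ xs) → All (λ a → a ≢ 0ℤ) xs →
                                   All (λ a → - a ∉ xs) xs
distinct-magnitudes⇒no-opposites {xs} distinct nonzero = All.tabulate λ {a} a∈ -a∈ →
  All.lookup nonzero a∈
    (self-opposite⇒≡0 a (Unique-map⇒injectiveOn distinct -a∈ a∈ (ℤ.∣-i∣≡∣i∣ a)))

distinct-magnitudes⇒IsDistinctCSn : ∀ {xs} → SumOfCubes≡SquareOfSum xs →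
                                    All (0 <_) (map ∣_∣ xs) → Unique (map ∣_∣ xs) →
                                    IsDistinctCSn (length xs) xs
distinct-magnitudes⇒IsDistinctCSn {xs} cs positive distinct =
  ((cs , nonzero , distinct-magnitudes⇒no-opposites distinct nonzero) , refl) ,
  Unique.map⁻ distinct
  where
  nonzero : All (λ a → a ≢ 0ℤ) xs
  nonzero = All.map positive-magnitude⇒≢0 (All.map⁻ positive)

map-∣∣-map-*ˡ : ∀ i xs → map ∣_∣ (map (i *_) xs) ≡ map (∣ i ∣ ℕ.*_) (map ∣_∣ xs)
map-∣∣-map-*ˡ i []       = refl
map-∣∣-map-*ˡ i (x ∷ xs) = cong₂ _∷_ (ℤ.∣i*j∣≡∣i∣*∣j∣ i x) (map-∣∣-map-*ˡ i xs)

map-∣∣-oneTo : ∀ m → map ∣_∣ (oneTo m) ≡ applyDownFrom suc m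
map-∣∣-oneTo zero    = refl
map-∣∣-oneTo (suc m) = cong (suc m ∷_) (map-∣∣-oneTo m)

Unique-applyDownFrom-suc : ∀ m → Unique (applyDownFrom suc m)
Unique-applyDownFrom-suc m = Unique.applyDownFrom⁺₁ suc m (λ j<i _ → ℕ.<⇒≢ (s≤s j<i) ∘ sym)

separated⇒Disjoint : ∀ {m xs ys} → All (m <_) xs → All (_≤ m) ys → Disjoint xs ys
separated⇒Disjoint xs>m ys≤m (v∈xs , v∈ys) =
  ℕ.<⇒≱ (All.lookup xs>m v∈xs) (All.lookup ys≤m v∈ys)

zeroBlock : List ℤ
zeroBlock = - + 9 ∷ + 8 ∷ + 7 ∷ - + 5 ∷ - + 1 ∷ []

zeroBlock-powerSumsVanish : PowerSumsVanish zeroBlock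
zeroBlock-powerSumsVanish = refl , refl

csFamily : ℕ → ℕ → List ℤ
csFamily t m = map (+ t *_) zeroBlock ++ oneTo m

module _ {m t : ℕ} (m<t : m < t) where

  private
    instance
      t≢0 : ℕ.NonZero t
      t≢0 = ℕ.>-nonZero (ℕ.≤-<-trans z≤n m<t)

    blockMagnitudes : List ℕ
    blockMagnitudes = map (t ℕ.*_) (map ∣_∣ zeroBlock)

    magnitudes : map ∣_∣ (csFamily t m) ≡ blockMagnitudes ++ applyDownFrom suc m
    magnitudes = trans (map-++ ∣_∣ (map (+ t *_) zeroBlock) (oneTo m))
                       (cong₂ _++_ (map-∣∣-map-*ˡ (+ t) zeroBlock) (map-∣∣-oneTo m))

    blockMagnitudes>m : All (m <_) blockMagnitudes
    blockMagnitudes>m = All.map⁺ (All.map (λ {k} 0<k → ℕ.<-≤-trans m<t (ℕ.m≤m*n t k {{ℕ.>-nonZero 0<k}}))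
                                 (from-yes (All.all? (0 ℕ.<?_) (map ∣_∣ zeroBlock))))

    positive : All (0 <_) (blockMagnitudes ++ applyDownFrom suc m)
    positive = All.++⁺ (All.map (ℕ.≤-<-trans z≤n) blockMagnitudes>m)
                       (All.applyDownFrom⁺₂ suc m (λ _ → ℕ.z<s))

    distinct : Unique (blockMagnitudes ++ applyDownFrom suc m)
    distinct = Unique.++⁺
      (Unique.map⁺ (ℕ.*-cancelˡ-≡ _ _ t) (from-yes (unique? (map ∣_∣ zeroBlock))))
      (Unique-applyDownFrom-suc m)
      (separated⇒Disjoint blockMagnitudes>m (All.applyDownFrom⁺₁ suc m (λ i<m → i<m)))

  csFamily-IsDistinctCSn : IsDistinctCSn (5 ℕ.+ m) (csFamily t m)
  csFamily-IsDistinctCSn =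
    subst (λ n → IsDistinctCSn n (csFamily t m)) (cong (5 ℕ.+_) (length-applyDownFrom _ m))
      (distinct-magnitudes⇒IsDistinctCSn
        (SumOfCubes≡SquareOfSum-++ (map (+ t *_) zeroBlock) (oneTo m)
          (PowerSumsVanish-map-*ˡ (+ t) zeroBlock zeroBlock-powerSumsVanish) (nicomachus m))
        (subst (All (0 <_)) (sym magnitudes) positive)
        (subst Unique (sym magnitudes) distinct))

csFamily-escapes : ∀ {B t} m → B < t → Any (λ a → B < ∣ a ∣) (csFamily t m)
csFamily-escapes {B} {t} m B<t =
  here (subst (B <_) (sym (ℤ.∣i*j∣≡∣i∣*∣j∣ (+ t) (- + 9))) (ℕ.<-≤-trans B<t (ℕ.m≤m*n t 9)))

bounded-magnitudes : (xs : List ℤ) → ∃ λ B → All (λ x → ∣ x ∣ ≤ B) xs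
bounded-magnitudes []       = 0 , All.[]
bounded-magnitudes (x ∷ xs) =
  let B , xs≤B = bounded-magnitudes xs
  in ∣ x ∣ ⊔ B , ℕ.m≤m⊔n ∣ x ∣ B All.∷ All.map (λ p → ℕ.≤-trans p (ℕ.m≤n⊔m ∣ x ∣ B)) xs≤B

unbounded⇒InfinitelyManyMultisets : ∀ {P : List ℤ → Set} →
  (∀ B → ∃ λ as → P as × Any (λ a → B < ∣ a ∣) as) → InfinitelyManyMultisets P
unbounded⇒InfinitelyManyMultisets large F =
  let B , F≤B = bounded-magnitudes (concat F)
      as , Pas , as>B = large B
  in as , Pas , All.map (λ bs≤B as↭bs →
       All.All¬⇒¬Any (All.map ℕ.≤⇒≯ bs≤B) (Any-resp-↭ as↭bs as>B))
     (All.concat⁻ F≤B)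

proposition11 : (n : ℕ) → n ≥ 5 → InfinitelyManyMultisets (IsDistinctCSn n)
proposition11 n n≥5 = unbounded⇒InfinitelyManyMultisets λ B →
  csFamily (t B) m ,
  subst (λ k → IsDistinctCSn k (csFamily (t B) m)) (ℕ.m+[n∸m]≡n n≥5)
        (csFamily-IsDistinctCSn (s≤s (ℕ.m≤m+n m B))) ,
  csFamily-escapes m (s≤s (ℕ.m≤n+m B m))
  where
  m : ℕ
  m = n ℕ.∸ 5
  t : ℕ → ℕ
  t B = suc (m ℕ.+ B)
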